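{- Let $m,n$ be positive integers and let $(\varphi,\varphi^*)$ be an $(m,n)$-reciprocal pair of skew-morphisms, $\varphi\colon\mathbb{Z}_n\to\mathbb{Z}_n$, $\varphi^*\colon\mathbb{Z}_m\to\mathbb{Z}_m$. Regard $\mathbb{Z}_n=\{0,1,\dots,n-1\}$ and $\mathbb{Z}_m=\{0',1',\dots,(m-1)'\}$ as disjoint sets, let $\rho=(0,1,\dots,n-1)$ and $\rho^*=(0',1',\dots,(m-1)')$ be the cyclic shifts, and extend $\varphi,\rho$ (resp. $\varphi^*,\rho^*$) to the disjoint union $\mathbb{Z}_n\cup\mathbb{Z}_m$ by letting them fix every point of $\mathbb{Z}_m$ (resp. $\mathbb{Z}_n$). Put $a=\varphi\rho^*$, $b=\varphi^*\rho$ and $G=\langle a,b\rangle\le\mathrm{Sym}(\mathbb{Z}_n\cup\mathbb{Z}_m)$. Then $|a|=m$, $|b|=n$, $\langle a\rangle\cap\langle b\rangle=1$ and $G=\langle a\rangle\langle b\rangle$, so $(G;a,b)$ is an exact $(m,n)$-bicyclic triple. Moreover, for all $x\in\mathbb{Z}_n$ and $y\in\mathbb{Z}_m$ we have $ab^x=b^{\varphi(x)}a^{k}$ and $ba^y=a^{\varphi^*(y)}b^{l}$ for suitable integers $k,l$; that is, $\varphi$ and $\varphi^*$ are exactly the skew-morphisms determined by the triple $(G;a,b)$ via the rules $ab^x=b^{\varphi(x)}a^{\pi(x)}$ and $ba^y=a^{\varphi^*(y)}b^{\pi^*(y)}$.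
   Context: A skew-morphism of a finite group $A$ is a bijection $\varphi\colon A\to A$ fixing the identity for which there is a function $\pi\colon A\to\mathbb{Z}$ (a power function) with $\varphi(xy)=\varphi(x)\varphi^{\pi(x)}(y)$ for all $x,y\in A$. A pair $(\varphi,\varphi^*)$ of skew-morphisms $\varphi$ of $\mathbb{Z}_n$ and $\varphi^*$ of $\mathbb{Z}_m$ is $(m,n)$-reciprocal if (i) $|\varphi|$ divides $m$ and $|\varphi^*|$ divides $n$, and (ii) $\pi(x)=-{\varphi^*}^{ -x}(-1)$ and $\pi^*(y)=-\varphi^{ -y}(-1)$ are power functions for $\varphi$ and $\varphi^*$, respectively. An exact $(m,n)$-bicyclic triple is a triple $(G;a,b)$ with $G$ a finite group, $|a|=m$, $|b|=n$, $G=\langle a\rangle\langle b\rangle$ and $\langle a\rangle\cap\langle b\rangle=1$. -}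

module Defs where

open import Data.Nat using (ℕ; zero; suc; _+_; _∸_; _<_; NonZero)
open import Data.Nat.Divisibility using (_∣_)
open import Data.Nat.DivMod using (_mod_)
open import Data.Fin using (Fin; toℕ)
open import Data.Integer using (ℤ; +_; -[1+_])
open import Data.Sum using (_⊎_; inj₁; inj₂)
import Data.Sum as Sum
open import Data.Product using (Σ; ∃; ∃-syntax; _×_; _,_)
open import Function using (_∘_; id; _↔_; Inverse)
open import Relation.Binary.PropositionalEquality using (_≡_; _≗_)
open import Relation.Nullary using (¬_)

open Inverse public using (to; from)

module _ (n : ℕ) .{{_ : NonZero n}} where

  0ₙ : Fin n
  0ₙ = 0 mod n

  -1ₙ : Fin n
  -1ₙ = (n ∸ 1) mod n

  infixl 6 _+ₙ_
  _+ₙ_ : Fin n → Fin n → Fin n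
  x +ₙ y = (toℕ x + toℕ y) mod n

  -ₙ_ : Fin n → Fin n
  -ₙ x = (n ∸ toℕ x) mod n

  ρ : Fin n → Fin n
  ρ x = (suc (toℕ x)) mod n

  ρ⁻¹ : Fin n → Fin n
  ρ⁻¹ x = (toℕ x + (n ∸ 1)) mod n

iter : ∀ {A : Set} → (A → A) → ℕ → A → A
iter f zero    = id
iter f (suc k) = f ∘ iter f k

zpow : ∀ {A : Set} → (f f⁻¹ : A → A) → ℤ → A → A
zpow f f⁻¹ (+ k)      = iter f k
zpow f f⁻¹ -[1+ k ]   = iter f⁻¹ (suc k)

_^ᶻ_ : ∀ {A : Set} → A ↔ A → ℤ → A → A
φ ^ᶻ k = zpow (to φ) (from φ) k

IsOrder : ∀ {A : Set} → (A → A) → ℕ → Set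
IsOrder f k = (0 < k) × (iter f k ≗ id)
            × (∀ j → 0 < j → j < k → ¬ (iter f j ≗ id))

OrderDivides : ∀ {A : Set} → (A → A) → ℕ → Set
OrderDivides f m = ∃[ k ] (IsOrder f k × k ∣ m)

module _ {n : ℕ} .{{_ : NonZero n}} where

  IsPowerFunction : Fin n ↔ Fin n → (Fin n → ℤ) → Set
  IsPowerFunction φ π =
    ∀ x y → to φ (_+ₙ_ n x y) ≡ _+ₙ_ n (to φ x) ((φ ^ᶻ π x) y)

  IsSkewMorphism : Fin n ↔ Fin n → Set
  IsSkewMorphism φ = (to φ (0ₙ n) ≡ 0ₙ n) × ∃[ π ] IsPowerFunction φ π

module _ {m n : ℕ} .{{_ : NonZero m}} .{{_ : NonZero n}} where

  -- π(x) = - φ*^{-x}(-1)  (computed in ℤ_m, exponent taken as its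
  -- representative in {0,…,m-1})
  recπ : Fin m ↔ Fin m → Fin n → ℤ
  recπ φ* x = + toℕ (-ₙ_ m (iter (from φ*) (toℕ x) (-1ₙ m)))

  recπ* : Fin n ↔ Fin n → Fin m → ℤ
  recπ* φ y = + toℕ (-ₙ_ n (iter (from φ) (toℕ y) (-1ₙ n)))

  IsReciprocal : Fin n ↔ Fin n → Fin m ↔ Fin m → Set
  IsReciprocal φ φ* =
    IsSkewMorphism φ × IsSkewMorphism φ*
    × OrderDivides (to φ) m × OrderDivides (to φ*) n
    × IsPowerFunction φ (recπ φ*) × IsPowerFunction φ* (recπ* φ)

extL : ∀ {A B : Set} → (A → A) → A ⊎ B → A ⊎ B
extL f = Sum.map f id

extR : ∀ {A B : Set} → (B → B) → A ⊎ B → A ⊎ B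
extR g = Sum.map id g

-- words in generators a, b and their inverses (composition is
-- right-to-left, as for functions)
data Word {P : Set} (a a⁻¹ b b⁻¹ : P → P) : (P → P) → Set where
  w-id  : Word a a⁻¹ b b⁻¹ id
  w-a   : ∀ {g} → Word a a⁻¹ b b⁻¹ g → Word a a⁻¹ b b⁻¹ (a ∘ g)
  w-a⁻¹ : ∀ {g} → Word a a⁻¹ b b⁻¹ g → Word a a⁻¹ b b⁻¹ (a⁻¹ ∘ g)
  w-b   : ∀ {g} → Word a a⁻¹ b b⁻¹ g → Word a a⁻¹ b b⁻¹ (b ∘ g)
  w-b⁻¹ : ∀ {g} → Word a a⁻¹ b b⁻¹ g → Word a a⁻¹ b b⁻¹ (b⁻¹ ∘ g)

InGen : ∀ {P : Set} → (a a⁻¹ b b⁻¹ : P → P) → (P → P) → Set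
InGen a a⁻¹ b b⁻¹ h = ∃[ g ] (Word a a⁻¹ b b⁻¹ g × h ≗ g)

module Construction {m n : ℕ} .{{_ : NonZero m}} .{{_ : NonZero n}}
                    (φ : Fin n ↔ Fin n) (φ* : Fin m ↔ Fin m) where

  Pt : Set
  Pt = Fin n ⊎ Fin m

  a a⁻¹ b b⁻¹ : Pt → Pt
  a   = extL (to φ) ∘ extR (ρ m)
  a⁻¹ = extL (from φ) ∘ extR (ρ⁻¹ m)
  b   = extR (to φ*) ∘ extL (ρ n)
  b⁻¹ = extR (from φ*) ∘ extL (ρ⁻¹ n)

  a^ b^ : ℤ → Pt → Pt
  a^ i = zpow a a⁻¹ i
  b^ j = zpow b b⁻¹ j

  InG : (Pt → Pt) → Set
  InG = InGen a a⁻¹ b b⁻¹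

-- The a-orbit of 0' is an m-cycle while b fixes 0', which gives |a| = m and
-- ⟨a⟩ ∩ ⟨b⟩ = 1 (and symmetrically |b| = n). The relation a b^x = b^{φ(x)} a^{π(x)} holds on
-- ℤ_n because π is a power function for φ; on ℤ_m it amounts to
-- φ*^{φ(x)}(y + π(x)) = φ*^x(y) + 1, which follows by writing y = u + v with u = φ*^{-x}(-1)
-- and iterating the power function of φ*: the exponents π* collected along the φ*-orbit of u
-- sum to φ(x) modulo n, and this is where reciprocity enters. The dual relation holds by
-- symmetry, and together they rewrite every word in a^{±1}, b^{±1} as some a^i b^j.
module Submission where

open import Defs
open import Data.Nat using (ℕ; zero; suc; _+_; _*_; _∸_; NonZero)
open import Data.Nat.Base using (>-nonZero⁻¹)
open import Data.Nat.Properties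
  using (+-comm; +-assoc; +-identityʳ; m∸n+n≡m; m+[n∸m]≡n; <⇒≤; <⇒≢)
open import Data.Nat.DivMod
  using (_%_; _/_; _mod_; %-distribˡ-+; [m+n]%n≡m%n; m%n<n; m<n⇒m%n≡m; m≡m%n+[m/n]*n)
open import Data.Nat.Divisibility using (divides)
open import Data.Fin using (Fin; toℕ)
open import Data.Fin.Properties using (toℕ-injective; toℕ-fromℕ<; toℕ<n)
open import Data.Integer using (ℤ; +_; -[1+_])
open import Data.Sum using (_⊎_; inj₁; inj₂)
import Data.Sum as Sum
open import Data.Sum.Properties
  using (inj₁-injective; inj₂-injective; map-cong; map-id; map-map)
open import Data.Product using (Σ; _×_; ∃-syntax; _,_)
open import Function using (_∘_; id; _↔_; _⇔_; Inverse; mk⇔)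
open import Relation.Binary.PropositionalEquality
open ≡-Reasoning

module Residue (n : ℕ) .{{_ : NonZero n}} where

  ⟦_⟧ : ℕ → Fin n
  ⟦ k ⟧ = k mod n

  toℕ-⟦⟧ : ∀ k → toℕ ⟦ k ⟧ ≡ k % n
  toℕ-⟦⟧ k = toℕ-fromℕ< (m%n<n k n)

  ⟦⟧-cong : ∀ {k l} → k % n ≡ l % n → ⟦ k ⟧ ≡ ⟦ l ⟧
  ⟦⟧-cong {k} {l} e = toℕ-injective (trans (toℕ-⟦⟧ k) (trans e (sym (toℕ-⟦⟧ l))))

  ⟦toℕ⟧ : ∀ x → ⟦ toℕ x ⟧ ≡ x
  ⟦toℕ⟧ x = toℕ-injective (trans (toℕ-⟦⟧ (toℕ x)) (m<n⇒m%n≡m (toℕ<n x)))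

  ⟦k+n⟧≡⟦k⟧ : ∀ k → ⟦ k + n ⟧ ≡ ⟦ k ⟧
  ⟦k+n⟧≡⟦k⟧ k = ⟦⟧-cong ([m+n]%n≡m%n k n)

  infixl 6 _⊕_
  _⊕_ : Fin n → Fin n → Fin n
  _⊕_ = _+ₙ_ n

  ⊖_ : Fin n → Fin n
  ⊖_ = -ₙ_ n

  ⟦⟧-+ : ∀ k l → ⟦ k + l ⟧ ≡ ⟦ k ⟧ ⊕ ⟦ l ⟧
  ⟦⟧-+ k l = ⟦⟧-cong (begin
    (k + l) % n                  ≡⟨ %-distribˡ-+ k l n ⟩
    (k % n + l % n) % n
      ≡⟨ cong₂ (λ u v → (u + v) % n) (toℕ-⟦⟧ k) (toℕ-⟦⟧ l) ⟨
    (toℕ ⟦ k ⟧ + toℕ ⟦ l ⟧) % n  ∎)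

  ⟦toℕ⟧⊕ : ∀ x y → ⟦ toℕ x ⟧ ⊕ y ≡ x ⊕ y
  ⟦toℕ⟧⊕ x y = cong (_⊕ y) (⟦toℕ⟧ x)

  ⊕-comm : ∀ x y → x ⊕ y ≡ y ⊕ x
  ⊕-comm x y = cong ⟦_⟧ (+-comm (toℕ x) (toℕ y))

  ⊕-assoc : ∀ x y z → (x ⊕ y) ⊕ z ≡ x ⊕ (y ⊕ z)
  ⊕-assoc x y z = begin
    (x ⊕ y) ⊕ z          ≡⟨ cong ((x ⊕ y) ⊕_) (⟦toℕ⟧ z) ⟨
    ⟦ X + Y ⟧ ⊕ ⟦ Z ⟧     ≡⟨ ⟦⟧-+ (X + Y) Z ⟨
    ⟦ X + Y + Z ⟧         ≡⟨ cong ⟦_⟧ (+-assoc X Y Z) ⟩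
    ⟦ X + (Y + Z) ⟧       ≡⟨ ⟦⟧-+ X (Y + Z) ⟩
    ⟦ X ⟧ ⊕ (y ⊕ z)       ≡⟨ ⟦toℕ⟧⊕ x (y ⊕ z) ⟩
    x ⊕ (y ⊕ z)           ∎
    where
    X Y Z : ℕ
    X = toℕ x
    Y = toℕ y
    Z = toℕ z

  ⊕-identityʳ : ∀ x → x ⊕ ⟦ 0 ⟧ ≡ x
  ⊕-identityʳ x = begin
    x ⊕ ⟦ 0 ⟧          ≡⟨ ⟦toℕ⟧⊕ x ⟦ 0 ⟧ ⟨
    ⟦ toℕ x ⟧ ⊕ ⟦ 0 ⟧  ≡⟨ ⟦⟧-+ (toℕ x) 0 ⟨
    ⟦ toℕ x + 0 ⟧      ≡⟨ cong ⟦_⟧ (+-identityʳ (toℕ x)) ⟩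
    ⟦ toℕ x ⟧          ≡⟨ ⟦toℕ⟧ x ⟩
    x                  ∎

  ⊕-inverseʳ : ∀ x → x ⊕ ⊖ x ≡ ⟦ 0 ⟧
  ⊕-inverseʳ x = begin
    x ⊕ ⊖ x                    ≡⟨ ⟦toℕ⟧⊕ x (⊖ x) ⟨
    ⟦ toℕ x ⟧ ⊕ ⟦ n ∸ toℕ x ⟧  ≡⟨ ⟦⟧-+ (toℕ x) (n ∸ toℕ x) ⟨
    ⟦ toℕ x + (n ∸ toℕ x) ⟧    ≡⟨ cong ⟦_⟧ (m+[n∸m]≡n (<⇒≤ (toℕ<n x))) ⟩
    ⟦ n ⟧                      ≡⟨ ⟦k+n⟧≡⟦k⟧ 0 ⟩
    ⟦ 0 ⟧                      ∎

  x⊕y⊕⊖y≡x : ∀ x y → x ⊕ y ⊕ ⊖ y ≡ x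
  x⊕y⊕⊖y≡x x y = begin
    x ⊕ y ⊕ ⊖ y     ≡⟨ ⊕-assoc x y (⊖ y) ⟩
    x ⊕ (y ⊕ ⊖ y)   ≡⟨ cong (x ⊕_) (⊕-inverseʳ y) ⟩
    x ⊕ ⟦ 0 ⟧       ≡⟨ ⊕-identityʳ x ⟩
    x               ∎

  y⊕[x⊕⊖y]≡x : ∀ x y → y ⊕ (x ⊕ ⊖ y) ≡ x
  y⊕[x⊕⊖y]≡x x y = trans (⊕-comm y (x ⊕ ⊖ y)) (begin
    x ⊕ ⊖ y ⊕ y     ≡⟨ ⊕-assoc x (⊖ y) y ⟩
    x ⊕ (⊖ y ⊕ y)   ≡⟨ cong (x ⊕_) (⊕-comm (⊖ y) y) ⟩
    x ⊕ (y ⊕ ⊖ y)   ≡⟨ ⊕-assoc x y (⊖ y) ⟨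
    x ⊕ y ⊕ ⊖ y     ≡⟨ x⊕y⊕⊖y≡x x y ⟩
    x               ∎)

  -1⊕1≡0 : -1ₙ n ⊕ ⟦ 1 ⟧ ≡ ⟦ 0 ⟧
  -1⊕1≡0 = begin
    ⟦ n ∸ 1 ⟧ ⊕ ⟦ 1 ⟧  ≡⟨ ⟦⟧-+ (n ∸ 1) 1 ⟨
    ⟦ n ∸ 1 + 1 ⟧      ≡⟨ cong ⟦_⟧ (m∸n+n≡m (>-nonZero⁻¹ n)) ⟩
    ⟦ n ⟧              ≡⟨ ⟦k+n⟧≡⟦k⟧ 0 ⟩
    ⟦ 0 ⟧              ∎

  ρ≡⊕1 : ∀ x → ρ n x ≡ x ⊕ ⟦ 1 ⟧
  ρ≡⊕1 x = begin
    ⟦ suc (toℕ x) ⟧      ≡⟨ cong ⟦_⟧ (+-comm 1 (toℕ x)) ⟩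
    ⟦ toℕ x + 1 ⟧        ≡⟨ ⟦⟧-+ (toℕ x) 1 ⟩
    ⟦ toℕ x ⟧ ⊕ ⟦ 1 ⟧    ≡⟨ ⟦toℕ⟧⊕ x ⟦ 1 ⟧ ⟩
    x ⊕ ⟦ 1 ⟧            ∎

  ρ[-1⊕x]≡x : ∀ x → ρ n (-1ₙ n ⊕ x) ≡ x
  ρ[-1⊕x]≡x x = begin
    ρ n (-1ₙ n ⊕ x)         ≡⟨ ρ≡⊕1 (-1ₙ n ⊕ x) ⟩
    -1ₙ n ⊕ x ⊕ ⟦ 1 ⟧       ≡⟨ ⊕-assoc (-1ₙ n) x ⟦ 1 ⟧ ⟩
    -1ₙ n ⊕ (x ⊕ ⟦ 1 ⟧)     ≡⟨ cong (-1ₙ n ⊕_) (⊕-comm x ⟦ 1 ⟧) ⟩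
    -1ₙ n ⊕ (⟦ 1 ⟧ ⊕ x)     ≡⟨ ⊕-assoc (-1ₙ n) ⟦ 1 ⟧ x ⟨
    -1ₙ n ⊕ ⟦ 1 ⟧ ⊕ x       ≡⟨ cong (_⊕ x) -1⊕1≡0 ⟩
    ⟦ 0 ⟧ ⊕ x               ≡⟨ ⊕-comm ⟦ 0 ⟧ x ⟩
    x ⊕ ⟦ 0 ⟧               ≡⟨ ⊕-identityʳ x ⟩
    x                       ∎

  ⟦suc⟧⊕-1 : ∀ k → ⟦ suc k ⟧ ⊕ -1ₙ n ≡ ⟦ k ⟧
  ⟦suc⟧⊕-1 k = begin
    ⟦ suc k ⟧ ⊕ -1ₙ n        ≡⟨ cong (λ t → ⟦ t ⟧ ⊕ -1ₙ n) (+-comm 1 k) ⟩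
    ⟦ k + 1 ⟧ ⊕ -1ₙ n        ≡⟨ cong (_⊕ -1ₙ n) (⟦⟧-+ k 1) ⟩
    ⟦ k ⟧ ⊕ ⟦ 1 ⟧ ⊕ -1ₙ n    ≡⟨ ⊕-assoc ⟦ k ⟧ ⟦ 1 ⟧ (-1ₙ n) ⟩
    ⟦ k ⟧ ⊕ (⟦ 1 ⟧ ⊕ -1ₙ n)  ≡⟨ cong (⟦ k ⟧ ⊕_) (⊕-comm ⟦ 1 ⟧ (-1ₙ n)) ⟩
    ⟦ k ⟧ ⊕ (-1ₙ n ⊕ ⟦ 1 ⟧)  ≡⟨ cong (⟦ k ⟧ ⊕_) -1⊕1≡0 ⟩
    ⟦ k ⟧ ⊕ ⟦ 0 ⟧            ≡⟨ ⊕-identityʳ ⟦ k ⟧ ⟩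
    ⟦ k ⟧                    ∎

  iter-ρ : ∀ k x → iter (ρ n) k x ≡ x ⊕ ⟦ k ⟧
  iter-ρ zero    x = sym (⊕-identityʳ x)
  iter-ρ (suc k) x = begin
    ρ n (iter (ρ n) k x)       ≡⟨ ρ≡⊕1 (iter (ρ n) k x) ⟩
    iter (ρ n) k x ⊕ ⟦ 1 ⟧     ≡⟨ cong (_⊕ ⟦ 1 ⟧) (iter-ρ k x) ⟩
    x ⊕ ⟦ k ⟧ ⊕ ⟦ 1 ⟧          ≡⟨ ⊕-assoc x ⟦ k ⟧ ⟦ 1 ⟧ ⟩
    x ⊕ (⟦ k ⟧ ⊕ ⟦ 1 ⟧)        ≡⟨ cong (x ⊕_) (⟦⟧-+ k 1) ⟨
    x ⊕ ⟦ k + 1 ⟧              ≡⟨ cong (λ t → x ⊕ ⟦ t ⟧) (+-comm k 1) ⟩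
    x ⊕ ⟦ suc k ⟧              ∎

  iter-ρ-toℕ : ∀ x z → iter (ρ n) (toℕ x) z ≡ z ⊕ x
  iter-ρ-toℕ x z = trans (iter-ρ (toℕ x) z) (cong (z ⊕_) (⟦toℕ⟧ x))

  iter-ρ-period : iter (ρ n) n ≗ id
  iter-ρ-period x = begin
    iter (ρ n) n x  ≡⟨ iter-ρ n x ⟩
    x ⊕ ⟦ n ⟧       ≡⟨ cong (x ⊕_) (⟦k+n⟧≡⟦k⟧ 0) ⟩
    x ⊕ ⟦ 0 ⟧       ≡⟨ ⊕-identityʳ x ⟩
    x               ∎

  ρ⁻¹≗iter-ρ : ρ⁻¹ n ≗ iter (ρ n) (n ∸ 1)
  ρ⁻¹≗iter-ρ x = begin
    ⟦ toℕ x + (n ∸ 1) ⟧        ≡⟨ ⟦⟧-+ (toℕ x) (n ∸ 1) ⟩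
    ⟦ toℕ x ⟧ ⊕ ⟦ n ∸ 1 ⟧      ≡⟨ ⟦toℕ⟧⊕ x ⟦ n ∸ 1 ⟧ ⟩
    x ⊕ ⟦ n ∸ 1 ⟧              ≡⟨ iter-ρ (n ∸ 1) x ⟨
    iter (ρ n) (n ∸ 1) x       ∎

  iter-ρ-orbit : ∀ k → iter (ρ n) k ⟦ 0 ⟧ ≡ ⟦ 0 ⟧ → k % n ≡ 0
  iter-ρ-orbit k e = begin
    k % n              ≡⟨ toℕ-⟦⟧ k ⟨
    toℕ ⟦ k ⟧          ≡⟨ cong toℕ ⟦k⟧≡⟦0⟧ ⟩
    toℕ ⟦ 0 ⟧          ≡⟨ toℕ-⟦⟧ 0 ⟩
    0 % n              ≡⟨ m<n⇒m%n≡m (>-nonZero⁻¹ n) ⟩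
    0                  ∎
    where
    ⟦k⟧≡⟦0⟧ : ⟦ k ⟧ ≡ ⟦ 0 ⟧
    ⟦k⟧≡⟦0⟧ = trans (⟦⟧-+ 0 k) (trans (sym (iter-ρ k ⟦ 0 ⟧)) e)

exponentℕ : ℕ → ℤ → ℕ
exponentℕ k (+ t)    = t
exponentℕ k -[1+ t ] = suc t * k

module _ {A : Set} (h : A → A) where

  iter-+ : ∀ k l x → iter h (k + l) x ≡ iter h k (iter h l x)
  iter-+ zero    l x = refl
  iter-+ (suc k) l x = cong h (iter-+ k l x)

  iter-sucʳ : ∀ k x → iter h (suc k) x ≡ iter h k (h x)
  iter-sucʳ k x = trans (cong (λ t → iter h t x) (+-comm 1 k)) (iter-+ k 1 x)

  iter-fixed : ∀ {p} → h p ≡ p → ∀ k → iter h k p ≡ p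
  iter-fixed e zero    = refl
  iter-fixed e (suc k) = trans (cong h (iter-fixed e k)) e

  iter-*-period : ∀ {k} → iter h k ≗ id → ∀ q x → iter h (q * k) x ≡ x
  iter-*-period period zero    x = refl
  iter-*-period {k} period (suc q) x =
    trans (iter-+ k (q * k) x) (trans (period _) (iter-*-period period q x))

  iter-% : ∀ k .{{_ : NonZero k}} → iter h k ≗ id
         → ∀ l x → iter h l x ≡ iter h (l % k) x
  iter-% k period l x = begin
    iter h l x                             ≡⟨ cong (λ t → iter h t x) (m≡m%n+[m/n]*n l k) ⟩
    iter h (l % k + l / k * k) x           ≡⟨ iter-+ (l % k) (l / k * k) x ⟩
    iter h (l % k) (iter h (l / k * k) x)
      ≡⟨ cong (iter h (l % k)) (iter-*-period period (l / k) x) ⟩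
    iter h (l % k) x                       ∎

  module _ (h⁻ : A → A) where

    iter-inverse : (∀ x → h (h⁻ x) ≡ x) → ∀ k x → iter h k (iter h⁻ k x) ≡ x
    iter-inverse inverse zero    x = refl
    iter-inverse inverse (suc k) x = begin
      iter h (suc k) (iter h⁻ (suc k) x)   ≡⟨ iter-sucʳ k _ ⟩
      iter h k (h (h⁻ (iter h⁻ k x)))      ≡⟨ cong (iter h k) (inverse _) ⟩
      iter h k (iter h⁻ k x)               ≡⟨ iter-inverse inverse k x ⟩
      x                                    ∎

    inverse≗iter : ∀ k .{{_ : NonZero k}} → (∀ x → h⁻ (h x) ≡ x) → iter h k ≗ id
                 → h⁻ ≗ iter h (k ∸ 1)
    inverse≗iter (suc k) inverse period x =
      trans (cong h⁻ (sym (period x))) (inverse (iter h k x))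

    zpow≗iter : ∀ {k} → h⁻ ≗ iter h k
              → ∀ i → zpow h h⁻ i ≗ iter h (exponentℕ k i)
    zpow≗iter inverse (+ t)    x = refl
    zpow≗iter {k} inverse -[1+ t ] x = iter⁻ (suc t) x
      where
      iter⁻ : ∀ t x → iter h⁻ t x ≡ iter h (t * k) x
      iter⁻ zero    x = refl
      iter⁻ (suc t) x = begin
        h⁻ (iter h⁻ t x)             ≡⟨ inverse _ ⟩
        iter h k (iter h⁻ t x)       ≡⟨ cong (iter h k) (iter⁻ t x) ⟩
        iter h k (iter h (t * k) x)  ≡⟨ iter-+ k (t * k) x ⟨
        iter h (k + t * k) x         ∎

iter-period-inverse : ∀ {A : Set} (h h⁻ : A → A) k → (∀ x → h⁻ (h x) ≡ x)
                    → iter h k ≗ id → iter h⁻ k ≗ id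
iter-period-inverse h h⁻ k inverse period x =
  trans (cong (iter h⁻ k) (sym (period x))) (iter-inverse h⁻ h inverse k x)

iter⁻¹≗iter-⊖ : ∀ {A : Set} (h h⁻ : A → A) k .{{_ : NonZero k}} → (∀ x → h⁻ (h x) ≡ x)
              → iter h k ≗ id → ∀ (w : Fin k) → iter h⁻ (toℕ w) ≗ iter h (toℕ (-ₙ_ k w))
iter⁻¹≗iter-⊖ h h⁻ k inverse period w x = sym (begin
  iter h (toℕ ⟦ k ∸ W ⟧) x                 ≡⟨ cong (λ t → iter h t x) (toℕ-⟦⟧ (k ∸ W)) ⟩
  iter h ((k ∸ W) % k) x                   ≡⟨ iter-% h k period (k ∸ W) x ⟨
  iter h (k ∸ W) x                         ≡⟨ iter-inverse h⁻ h inverse W _ ⟨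
  iter h⁻ W (iter h W (iter h (k ∸ W) x))  ≡⟨ cong (iter h⁻ W) (iter-+ h W (k ∸ W) x) ⟨
  iter h⁻ W (iter h (W + (k ∸ W)) x)
    ≡⟨ cong (λ t → iter h⁻ W (iter h t x)) (m+[n∸m]≡n (<⇒≤ (toℕ<n w))) ⟩
  iter h⁻ W (iter h k x)                   ≡⟨ cong (iter h⁻ W) (period x) ⟩
  iter h⁻ W x                              ∎)
  where
  open Residue k using (⟦_⟧; toℕ-⟦⟧)
  W : ℕ
  W = toℕ w

iter-map : ∀ {A B : Set} {h : A ⊎ B → A ⊎ B} {u : A → A} {v : B → B}
         → h ≗ Sum.map u v → ∀ k → iter h k ≗ Sum.map (iter u k) (iter v k)
iter-map h≗ zero    x = sym (map-id x)
iter-map {h = h} {u} {v} h≗ (suc k) x = begin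
  h (iter h k x)                                  ≡⟨ h≗ _ ⟩
  Sum.map u v (iter h k x)                        ≡⟨ cong (Sum.map u v) (iter-map h≗ k x) ⟩
  Sum.map u v (Sum.map (iter u k) (iter v k) x)   ≡⟨ map-map x ⟩
  Sum.map (iter u (suc k)) (iter v (suc k)) x     ∎

OrderDivides⇒iter≗id : ∀ {A : Set} (h : A → A) m → OrderDivides h m → iter h m ≗ id
OrderDivides⇒iter≗id h m (k , (_ , period , _) , divides q refl) = iter-*-period h period q

orbit⇒IsOrder : ∀ {A : Set} (h : A → A) k .{{_ : NonZero k}} (p : A) → iter h k ≗ id
              → (∀ j → iter h j p ≡ p → j % k ≡ 0) → IsOrder h k
orbit⇒IsOrder h k p period orbit = >-nonZero⁻¹ k , period , λ j 0<j j<k hʲ≗id →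
  <⇒≢ 0<j (sym (trans (sym (m<n⇒m%n≡m j<k)) (orbit j (hʲ≗id p))))

module _ {P : Set} {a a⁻¹ b b⁻¹ : P → P} where

  private
    W : (P → P) → Set
    W = Word a a⁻¹ b b⁻¹

  Word-iter : ∀ {c} → (∀ {g} → W g → W (c ∘ g)) → ∀ k {g} → W g → W (iter c k ∘ g)
  Word-iter extend zero    w = w
  Word-iter extend (suc k) w = extend (Word-iter extend k w)

  Word-zpow : ∀ {c c⁻} → (∀ {g} → W g → W (c ∘ g)) → (∀ {g} → W g → W (c⁻ ∘ g))
            → ∀ i {g} → W g → W (zpow c c⁻ i ∘ g)
  Word-zpow extend extend⁻ (+ k)    w = Word-iter extend k w
  Word-zpow {c⁻ = c⁻} extend extend⁻ -[1+ k ] w = Word-iter {c = c⁻} extend⁻ (suc k) w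

module SkewIteration {n : ℕ} .{{_ : NonZero n}} (φ : Fin n ↔ Fin n) (π : Fin n → ℕ)
                     (power : IsPowerFunction φ (+_ ∘ π)) where

  open Residue n

  powerSum : Fin n → ℕ → ℕ
  powerSum u zero    = 0
  powerSum u (suc t) = powerSum (to φ u) t + π u

  iter-⊕ : ∀ t u v
         → iter (to φ) t (u ⊕ v) ≡ iter (to φ) t u ⊕ iter (to φ) (powerSum u t) v
  iter-⊕ zero    u v = refl
  iter-⊕ (suc t) u v = begin
    iter f (suc t) (u ⊕ v)                               ≡⟨ iter-sucʳ f t _ ⟩
    iter f t (f (u ⊕ v))                                 ≡⟨ cong (iter f t) (power u v) ⟩
    iter f t (f u ⊕ iter f (π u) v)                      ≡⟨ iter-⊕ t (f u) _ ⟩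
    iter f t (f u) ⊕ iter f (powerSum (f u) t) (iter f (π u) v)
      ≡⟨ cong₂ _⊕_ (iter-sucʳ f t u) (iter-+ f (powerSum (f u) t) (π u) v) ⟨
    iter f (suc t) u ⊕ iter f (powerSum u (suc t)) v      ∎
    where
    f : Fin n → Fin n
    f = to φ

module Reciprocity {m n : ℕ} .{{_ : NonZero m}} .{{_ : NonZero n}}
  (φ : Fin n ↔ Fin n) (φ* : Fin m ↔ Fin m)
  (φ-fixes-0 : to φ (0ₙ n) ≡ 0ₙ n)
  (φ-period : iter (to φ) m ≗ id) (φ*-period : iter (to φ*) n ≗ id)
  (π-power : IsPowerFunction φ (recπ φ*)) (π*-power : IsPowerFunction φ* (recπ* φ)) where

  private
    module N = Residue n
    module M = Residue m
    f f⁻ : Fin n → Fin n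
    f  = to φ
    f⁻ = from φ
    g g⁻ : Fin m → Fin m
    g  = to φ*
    g⁻ = from φ*
    f⁻∘f : ∀ z → f⁻ (f z) ≡ z
    f⁻∘f = Inverse.strictlyInverseʳ φ
    g∘g⁻ : ∀ y → g (g⁻ y) ≡ y
    g∘g⁻ = Inverse.strictlyInverseˡ φ*
    g⁻∘g : ∀ y → g⁻ (g y) ≡ y
    g⁻∘g = Inverse.strictlyInverseʳ φ*

  φ*⁻ᵏ[-1] : ℕ → Fin m
  φ*⁻ᵏ[-1] k = iter g⁻ k (-1ₙ m)

  π : Fin n → ℕ
  π x = toℕ (M.⊖ φ*⁻ᵏ[-1] (toℕ x))

  π* : Fin m → ℕ
  π* y = toℕ (N.⊖ iter f⁻ (toℕ y) (-1ₙ n))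

  open SkewIteration φ* π* π*-power

  φ*⁻ᵏ[-1]-% : ∀ k → φ*⁻ᵏ[-1] (toℕ N.⟦ k ⟧) ≡ φ*⁻ᵏ[-1] k
  φ*⁻ᵏ[-1]-% k = begin
    iter g⁻ (toℕ N.⟦ k ⟧) (-1ₙ m)  ≡⟨ cong (λ t → iter g⁻ t (-1ₙ m)) (N.toℕ-⟦⟧ k) ⟩
    iter g⁻ (k % n) (-1ₙ m)        ≡⟨ iter-% g⁻ n g⁻-period k (-1ₙ m) ⟨
    iter g⁻ k (-1ₙ m)              ∎
    where
    g⁻-period : iter g⁻ n ≗ id
    g⁻-period = iter-period-inverse g g⁻ n g⁻∘g φ*-period

  -- The step k → k+1 adds π*(φ*^{-(k+1)}(-1)) = -φ^{π(k+1)}(-1), and the power-function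
  -- identity φ(k) = φ((k+1) + (-1)) = φ(k+1) + φ^{π(k+1)}(-1) cancels it.
  powerSum-orbit : ∀ k → N.⟦ powerSum (φ*⁻ᵏ[-1] k) k ⟧ ≡ f N.⟦ k ⟧
  powerSum-orbit zero    = sym φ-fixes-0
  powerSum-orbit (suc k) = begin
    N.⟦ powerSum (g u) k + π* u ⟧                 ≡⟨ N.⟦⟧-+ _ (π* u) ⟩
    N.⟦ powerSum (g u) k ⟧ N.⊕ N.⟦ π* u ⟧         ≡⟨ cong₂ N._⊕_ powerSum-gu (N.⟦toℕ⟧ _) ⟩
    f N.⟦ k ⟧ N.⊕ N.⊖ iter f⁻ (toℕ u) (-1ₙ n)    ≡⟨ cong (λ t → f N.⟦ k ⟧ N.⊕ N.⊖ t) f⁻ᵘ[-1]≡c ⟩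
    f N.⟦ k ⟧ N.⊕ N.⊖ c                          ≡⟨ cong (λ t → t N.⊕ N.⊖ c) f⟦k⟧≡fx⊕c ⟩
    f x N.⊕ c N.⊕ N.⊖ c                          ≡⟨ N.x⊕y⊕⊖y≡x (f x) c ⟩
    f x                                          ∎
    where
    u : Fin m
    u = φ*⁻ᵏ[-1] (suc k)
    x c : Fin n
    x = N.⟦ suc k ⟧
    c = iter f (π x) (-1ₙ n)
    powerSum-gu : N.⟦ powerSum (g u) k ⟧ ≡ f N.⟦ k ⟧
    powerSum-gu = trans (cong (λ t → N.⟦ powerSum t k ⟧) (g∘g⁻ _)) (powerSum-orbit k)
    f⁻ᵘ[-1]≡c : iter f⁻ (toℕ u) (-1ₙ n) ≡ c
    f⁻ᵘ[-1]≡c = begin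
      iter f⁻ (toℕ u) (-1ₙ n)              ≡⟨ iter⁻¹≗iter-⊖ f f⁻ m f⁻∘f φ-period u (-1ₙ n) ⟩
      iter f (toℕ (M.⊖ u)) (-1ₙ n)
        ≡⟨ cong (λ t → iter f (toℕ (M.⊖ t)) (-1ₙ n)) (φ*⁻ᵏ[-1]-% (suc k)) ⟨
      c                                    ∎
    f⟦k⟧≡fx⊕c : f N.⟦ k ⟧ ≡ f x N.⊕ c
    f⟦k⟧≡fx⊕c = trans (cong f (sym (N.⟦suc⟧⊕-1 k))) (π-power x (-1ₙ n))

  φ-shift : ∀ x z → f (iter (ρ n) (toℕ x) z) ≡ iter (ρ n) (toℕ (f x)) (iter f (π x) z)
  φ-shift x z = begin
    f (iter (ρ n) (toℕ x) z)                  ≡⟨ cong f (N.iter-ρ-toℕ x z) ⟩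
    f (z N.⊕ x)                               ≡⟨ cong f (N.⊕-comm z x) ⟩
    f (x N.⊕ z)                               ≡⟨ π-power x z ⟩
    f x N.⊕ iter f (π x) z                    ≡⟨ N.⊕-comm (f x) _ ⟩
    iter f (π x) z N.⊕ f x                    ≡⟨ N.iter-ρ-toℕ (f x) _ ⟨
    iter (ρ n) (toℕ (f x)) (iter f (π x) z)   ∎

  iter-φ*-φ : ∀ x → iter g (toℕ (f x)) ≗ iter g (powerSum (φ*⁻ᵏ[-1] (toℕ x)) (toℕ x))
  iter-φ*-φ x v = begin
    iter g (toℕ (f x)) v       ≡⟨ cong (λ t → iter g (toℕ (f t)) v) (N.⟦toℕ⟧ x) ⟨
    iter g (toℕ (f N.⟦ X ⟧)) v ≡⟨ cong (λ t → iter g (toℕ t) v) (powerSum-orbit X) ⟨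
    iter g (toℕ N.⟦ s ⟧) v     ≡⟨ cong (λ t → iter g t v) (N.toℕ-⟦⟧ s) ⟩
    iter g (s % n) v           ≡⟨ iter-% g n φ*-period s v ⟨
    iter g s v                 ∎
    where
    X s : ℕ
    X = toℕ x
    s = powerSum (φ*⁻ᵏ[-1] X) X

  -- Split y = u ⊕ v with u = φ*^{-x}(-1), so that φ*^x(u) = -1 is absorbed by ρ*.
  φ*-shift : ∀ x y → iter g (toℕ (f x)) (iter (ρ m) (π x) y) ≡ ρ m (iter g (toℕ x) y)
  φ*-shift x y = begin
    iter g (toℕ (f x)) (iter (ρ m) (π x) y)  ≡⟨ cong (iter g (toℕ (f x))) (M.iter-ρ (π x) y) ⟩
    iter g (toℕ (f x)) (y M.⊕ M.⟦ π x ⟧)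
      ≡⟨ cong (λ t → iter g (toℕ (f x)) (y M.⊕ t)) (M.⟦toℕ⟧ _) ⟩
    iter g (toℕ (f x)) v                     ≡⟨ iter-φ*-φ x v ⟩
    iter g s v                               ≡⟨ M.ρ[-1⊕x]≡x _ ⟨
    ρ m (-1ₙ m M.⊕ iter g s v)               ≡⟨ cong (λ t → ρ m (t M.⊕ iter g s v)) gˣu≡-1 ⟨
    ρ m (iter g X u M.⊕ iter g s v)          ≡⟨ cong (ρ m) (iter-⊕ X u v) ⟨
    ρ m (iter g X (u M.⊕ v))                 ≡⟨ cong (ρ m ∘ iter g X) (M.y⊕[x⊕⊖y]≡x y u) ⟩
    ρ m (iter g X y)                         ∎
    where
    X : ℕ
    X = toℕ x
    u v : Fin m
    u = φ*⁻ᵏ[-1] X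
    v = y M.⊕ M.⊖ u
    s : ℕ
    s = powerSum u X
    gˣu≡-1 : iter g X u ≡ -1ₙ m
    gˣu≡-1 = iter-inverse g g⁻ g∘g⁻ X (-1ₙ m)

module BicyclicTriple {m n : ℕ} .{{_ : NonZero m}} .{{_ : NonZero n}}
  (φ : Fin n ↔ Fin n) (φ* : Fin m ↔ Fin m)
  (φ-fixes-0 : to φ (0ₙ n) ≡ 0ₙ n) (φ*-fixes-0 : to φ* (0ₙ m) ≡ 0ₙ m)
  (φ-period : iter (to φ) m ≗ id) (φ*-period : iter (to φ*) n ≗ id)
  (π-power : IsPowerFunction φ (recπ φ*)) (π*-power : IsPowerFunction φ* (recπ* φ)) where

  open Construction φ φ*
  private
    module R = Reciprocity φ φ* φ-fixes-0 φ-period φ*-period π-power π*-power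
  open R public using (π; π*)
  private
    module N = Residue n
    module M = Residue m
    module R* = Reciprocity φ* φ φ*-fixes-0 φ*-period φ-period π*-power π-power
    f : Fin n → Fin n
    f = to φ
    g : Fin m → Fin m
    g = to φ*

  iter-a : ∀ k → iter a k ≗ Sum.map (iter f k) (iter (ρ m) k)
  iter-a = iter-map (map-map {f = id} {g = ρ m} {f′ = f} {g′ = id})

  iter-b : ∀ k → iter b k ≗ Sum.map (iter (ρ n) k) (iter g k)
  iter-b = iter-map (map-map {f = ρ n} {g = id} {f′ = id} {g′ = g})

  iter-a∘iter-b : ∀ k l
                → iter a k ∘ iter b l ≗ Sum.map (iter f k ∘ iter (ρ n) l) (iter (ρ m) k ∘ iter g l)
  iter-a∘iter-b k l p = trans (cong (iter a k) (iter-b l p)) (trans (iter-a k _) (map-map p))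

  iter-b∘iter-a : ∀ k l
                → iter b k ∘ iter a l ≗ Sum.map (iter (ρ n) k ∘ iter f l) (iter g k ∘ iter (ρ m) l)
  iter-b∘iter-a k l p = trans (cong (iter b k) (iter-a l p)) (trans (iter-b k _) (map-map p))

  a-period : iter a m ≗ id
  a-period p = trans (iter-a m p) (trans (map-cong φ-period M.iter-ρ-period p) (map-id p))

  b-period : iter b n ≗ id
  b-period p = trans (iter-b n p) (trans (map-cong N.iter-ρ-period φ*-period p) (map-id p))

  a-orbit : ∀ k → iter a k (inj₂ (0ₙ m)) ≡ inj₂ (0ₙ m) → k % m ≡ 0
  a-orbit k e = M.iter-ρ-orbit k (inj₂-injective (trans (sym (iter-a k _)) e))

  b-orbit : ∀ k → iter b k (inj₁ (0ₙ n)) ≡ inj₁ (0ₙ n) → k % n ≡ 0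
  b-orbit k e = N.iter-ρ-orbit k (inj₁-injective (trans (sym (iter-b k _)) e))

  a⁻¹≗iter-a : a⁻¹ ≗ iter a (m ∸ 1)
  a⁻¹≗iter-a p = trans (map-map p) (trans (map-cong f⁻≗ M.ρ⁻¹≗iter-ρ p) (sym (iter-a (m ∸ 1) p)))
    where
    f⁻≗ : from φ ≗ iter f (m ∸ 1)
    f⁻≗ = inverse≗iter f (from φ) m (Inverse.strictlyInverseʳ φ) φ-period

  b⁻¹≗iter-b : b⁻¹ ≗ iter b (n ∸ 1)
  b⁻¹≗iter-b p = trans (map-map p) (trans (map-cong N.ρ⁻¹≗iter-ρ g⁻≗ p) (sym (iter-b (n ∸ 1) p)))
    where
    g⁻≗ : from φ* ≗ iter g (n ∸ 1)
    g⁻≗ = inverse≗iter g (from φ*) n (Inverse.strictlyInverseʳ φ*) φ*-period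

  ⟨a⟩∩⟨b⟩≡1 : ∀ i j → a^ i ≗ b^ j → a^ i ≗ id
  ⟨a⟩∩⟨b⟩≡1 i j aⁱ≗bʲ p = begin
    a^ i p              ≡⟨ zpow≗iter a a⁻¹ a⁻¹≗iter-a i p ⟩
    iter a k p          ≡⟨ iter-% a m a-period k p ⟩
    iter a (k % m) p    ≡⟨ cong (λ t → iter a t p) (a-orbit k aᵏo≡o) ⟩
    p                   ∎
    where
    k l : ℕ
    k = exponentℕ (m ∸ 1) i
    l = exponentℕ (n ∸ 1) j
    o : Pt
    o = inj₂ (0ₙ m)
    aᵏo≡o : iter a k o ≡ o
    aᵏo≡o = begin
      iter a k o               ≡⟨ zpow≗iter a a⁻¹ a⁻¹≗iter-a i o ⟨
      a^ i o                   ≡⟨ aⁱ≗bʲ o ⟩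
      b^ j o                   ≡⟨ zpow≗iter b b⁻¹ b⁻¹≗iter-b j o ⟩
      iter b l o               ≡⟨ iter-b l o ⟩
      inj₂ (iter g l (0ₙ m))   ≡⟨ cong inj₂ (iter-fixed g φ*-fixes-0 l) ⟩
      o                        ∎

  a∘bˣ≗bᶠˣ∘aᵏ : ∀ x → a ∘ iter b (toℕ x) ≗ iter b (toℕ (f x)) ∘ iter a (π x)
  a∘bˣ≗bᶠˣ∘aᵏ x p = begin
    a (iter b X p)                                           ≡⟨ iter-a∘iter-b 1 X p ⟩
    Sum.map (f ∘ iter (ρ n) X) (ρ m ∘ iter g X) p
      ≡⟨ map-cong (R.φ-shift x) (sym ∘ R.φ*-shift x) p ⟩
    Sum.map (iter (ρ n) F ∘ iter f k) (iter g F ∘ iter (ρ m) k) p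
                                                             ≡⟨ iter-b∘iter-a F k p ⟨
    iter b F (iter a k p)                                    ∎
    where
    X F k : ℕ
    X = toℕ x
    F = toℕ (f x)
    k = π x

  b∘aʸ≗aᵍʸ∘bˡ : ∀ y → b ∘ iter a (toℕ y) ≗ iter a (toℕ (g y)) ∘ iter b (π* y)
  b∘aʸ≗aᵍʸ∘bˡ y p = begin
    b (iter a Y p)                                           ≡⟨ iter-b∘iter-a 1 Y p ⟩
    Sum.map (ρ n ∘ iter f Y) (g ∘ iter (ρ m) Y) p
      ≡⟨ map-cong (sym ∘ R*.φ*-shift y) (R*.φ-shift y) p ⟩
    Sum.map (iter f G ∘ iter (ρ n) l) (iter (ρ m) G ∘ iter g l) p
                                                             ≡⟨ iter-a∘iter-b G l p ⟨
    iter a G (iter b l p)                                    ∎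
    where
    Y G l : ℕ
    Y = toℕ y
    G = toℕ (g y)
    l = π* y

  NormalForm : (Pt → Pt) → Set
  NormalForm h = Σ ℕ λ i → Σ ℕ λ j → h ≗ iter a i ∘ iter b j

  b∘-NormalForm : ∀ {h} → NormalForm h → NormalForm (b ∘ h)
  b∘-NormalForm {h} (i , j , h≗) = toℕ (g y) , π* y + j , λ p → begin
    b (h p)                                    ≡⟨ cong b (h≗ p) ⟩
    b (iter a i (iter b j p))                  ≡⟨ cong b (iter-% a m a-period i _) ⟩
    b (iter a (i % m) (iter b j p))
      ≡⟨ cong (λ t → b (iter a t (iter b j p))) (M.toℕ-⟦⟧ i) ⟨
    b (iter a (toℕ y) (iter b j p))            ≡⟨ b∘aʸ≗aᵍʸ∘bˡ y _ ⟩
    iter a (toℕ (g y)) (iter b l (iter b j p)) ≡⟨ cong (iter a (toℕ (g y))) (iter-+ b l j p) ⟨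
    iter a (toℕ (g y)) (iter b (l + j) p)      ∎
    where
    y : Fin m
    y = M.⟦ i ⟧
    l : ℕ
    l = π* y

  iter-b∘-NormalForm : ∀ k {h} → NormalForm h → NormalForm (iter b k ∘ h)
  iter-b∘-NormalForm zero    nf = nf
  iter-b∘-NormalForm (suc k) nf = b∘-NormalForm (iter-b∘-NormalForm k nf)

  NormalForm-resp : ∀ {h h′} → h ≗ h′ → NormalForm h′ → NormalForm h
  NormalForm-resp h≗h′ (i , j , h′≗) = i , j , λ p → trans (h≗h′ p) (h′≗ p)

  Word⇒NormalForm : ∀ {h} → Word a a⁻¹ b b⁻¹ h → NormalForm h
  Word⇒NormalForm w-id      = 0 , 0 , λ p → refl
  Word⇒NormalForm (w-a w) with Word⇒NormalForm w
  ... | i , j , h≗ = suc i , j , cong a ∘ h≗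
  Word⇒NormalForm (w-a⁻¹ w) with Word⇒NormalForm w
  ... | i , j , h≗ = m ∸ 1 + i , j , λ p →
    trans (a⁻¹≗iter-a _) (trans (cong (iter a (m ∸ 1)) (h≗ p)) (sym (iter-+ a (m ∸ 1) i _)))
  Word⇒NormalForm (w-b w)   = b∘-NormalForm (Word⇒NormalForm w)
  Word⇒NormalForm (w-b⁻¹ w) =
    NormalForm-resp (b⁻¹≗iter-b ∘ _) (iter-b∘-NormalForm (n ∸ 1) (Word⇒NormalForm w))

  InG⇔aⁱbʲ : ∀ h → InG h ⇔ (∃[ i ] ∃[ j ] (h ≗ a^ i ∘ b^ j))
  InG⇔aⁱbʲ h = mk⇔ toProduct fromProduct
    where
    toProduct : InG h → ∃[ i ] ∃[ j ] (h ≗ a^ i ∘ b^ j)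
    toProduct (_ , w , h≗) with Word⇒NormalForm w
    ... | i , j , w≗ = + i , + j , λ p → trans (h≗ p) (w≗ p)
    fromProduct : ∃[ i ] ∃[ j ] (h ≗ a^ i ∘ b^ j) → InG h
    fromProduct (i , j , h≗) = a^ i ∘ b^ j , Word-zpow w-a w-a⁻¹ i (Word-zpow w-b w-b⁻¹ j w-id) , h≗

proposition2 : (m n : ℕ) .{{_ : NonZero m}} .{{_ : NonZero n}}
    → (φ : Fin n ↔ Fin n) (φ* : Fin m ↔ Fin m)
    → IsReciprocal φ φ*
    → let open Construction φ φ* in
    IsOrder a m
    × IsOrder b n
    × (∀ (i j : ℤ) → a^ i ≗ b^ j → a^ i ≗ id)
    × (∀ (h : Pt → Pt) → InG h ⇔ (∃[ i ] ∃[ j ] (h ≗ a^ i ∘ b^ j)))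
    × (∀ (x : Fin n) → ∃[ k ] (a ∘ b^ (+ toℕ x) ≗ b^ (+ toℕ (to φ x)) ∘ a^ k))
    × (∀ (y : Fin m) → ∃[ l ] (b ∘ a^ (+ toℕ y) ≗ a^ (+ toℕ (to φ* y)) ∘ b^ l))
proposition2 m n φ φ* ((φ-fixes-0 , _) , (φ*-fixes-0 , _) , ordφ∣m , ordφ*∣n , π-power , π*-power) =
    orbit⇒IsOrder a m (inj₂ (0ₙ m)) a-period a-orbit
  , orbit⇒IsOrder b n (inj₁ (0ₙ n)) b-period b-orbit
  , ⟨a⟩∩⟨b⟩≡1
  , InG⇔aⁱbʲ
  , (λ x → + π x , a∘bˣ≗bᶠˣ∘aᵏ x)
  , (λ y → + π* y , b∘aʸ≗aᵍʸ∘bˡ y)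
  where
  open Construction φ φ*
  open BicyclicTriple φ φ* φ-fixes-0 φ*-fixes-0
         (OrderDivides⇒iter≗id (to φ) m ordφ∣m) (OrderDivides⇒iter≗id (to φ*) n ordφ*∣n)
         π-power π*-power
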